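{- For integers $n\ge 1$ and $k\ge 3$, let $D(n,k)$ be the digraph whose vertex set is the disjoint union of $k$ sets $V_1,\dots,V_k$ of size $n$ each, and whose arc set is $\bigcup_{i=1}^{k} (V_i\times V_{i+1})$ with indices taken modulo $k$ (so $V_{k+1}:=V_1$); i.e., $D(n,k)$ is obtained from the directed cycle $\vec C_k$ by replacing each vertex by $n$ independent copies. Then ${\rm adi}(D(n,k))\le k$ and $\tau(D(n,k))=n$.
   Context: Digraphs are finite and loopless. A \emph{complete acyclic coloring} of a digraph $D$ is a partition of $V(D)$ into color classes such that each color class induces an acyclic subdigraph (no directed cycle), but for any two distinct color classes, their union induces a subdigraph containing a directed cycle. The \emph{adichromatic number} ${\rm adi}(D)$ is the largest number of colors in a complete acyclic coloring of $D$. A \emph{feedback vertex set} of $D$ is a set $F\subseteq V(D)$ such that $D-F$ is acyclic; $\tau(D)$ is the minimum size of a feedback vertex set. -}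

module Defs where

open import Data.Nat using (ℕ; zero; suc; _<_; _≤_)
open import Data.Fin using (Fin; toℕ)
open import Data.Product using (_×_; Σ; ∃; _,_)
open import Data.Sum using (_⊎_)
open import Data.List using (List; length)
open import Data.List.Membership.Propositional using (_∈_; _∉_)
open import Data.List.Relation.Unary.Unique.Propositional using (Unique)
open import Function.Definitions using (Injective; Surjective)
open import Relation.Binary.PropositionalEquality using (_≡_)
open import Relation.Nullary using (¬_)

record Digraph : Set₁ where
  field
    V   : Set
    Arc : V → V → Set
open Digraph public

-- j is the cyclic successor of i in Fin m, i.e. toℕ j ≡ (toℕ i + 1) mod m.
CycSucc : (m : ℕ) → Fin m → Fin m → Set
CycSucc m i j = (suc (toℕ i) < m × toℕ j ≡ suc (toℕ i))
              ⊎ (suc (toℕ i) ≡ m × toℕ j ≡ 0)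

-- A directed cycle of D with all vertices in the vertex set S (i.e. a directed
-- cycle of the subdigraph induced by S): distinct vertices c 0, …, c (l-1)
-- with arcs c i → c (i+1 mod l).
record DirCycleIn (D : Digraph) (S : V D → Set) : Set where
  field
    len   : ℕ
    vtx   : Fin (suc len) → V D
    inj   : Injective _≡_ _≡_ vtx
    arcs  : ∀ i j → CycSucc (suc len) i j → Arc D (vtx i) (vtx j)
    inS   : ∀ i → S (vtx i)

AcyclicOn : (D : Digraph) → (V D → Set) → Set
AcyclicOn D S = ¬ DirCycleIn D S

IsCompleteAcyclicColoring : (D : Digraph) (r : ℕ) → (V D → Fin r) → Set
IsCompleteAcyclicColoring D r col =
    Surjective _≡_ _≡_ col
  × (∀ a → AcyclicOn D (λ v → col v ≡ a))
  × (∀ a b → ¬ a ≡ b → DirCycleIn D (λ v → col v ≡ a ⊎ col v ≡ b))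

AdiAtMost : Digraph → ℕ → Set
AdiAtMost D k = ∀ r (col : V D → Fin r) → IsCompleteAcyclicColoring D r col → r ≤ k

IsFVS : (D : Digraph) → List (V D) → Set
IsFVS D F = AcyclicOn D (λ v → v ∉ F)

TauEq : Digraph → ℕ → Set
TauEq D t = (Σ (List (V D)) λ F → Unique F × length F ≡ t × IsFVS D F)
          × (∀ F → IsFVS D F → t ≤ length F)

-- D(n,k): vertex (i , a) is copy a of vertex i of the directed k-cycle.
Dnk : ℕ → ℕ → Digraph
Dnk n k = record
  { V   = Fin k × Fin n
  ; Arc = λ { (i , _) (j , _) → CycSucc k i j } }

module Submission where

-- Everything rests on two facts about the layers of D(n,k):
--   (A) a vertex set meeting every layer contains a directed cycle, namely a
--       transversal (i, f i)_i running once around the base cycle;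
--   (B) a vertex set missing some layer c is acyclic: cutting the base cycle
--       at c turns the layer index into a potential that strictly increases
--       along every arc, and such a potential forbids directed cycles.
-- By (A) each colour class of an acyclic colouring misses some layer; by (B)
-- two classes of a complete colouring cannot miss the same layer, so the map
-- "class ↦ missed layer" is injective and there are at most k colours.
-- For τ: one whole layer is a feedback vertex set of size n by (B), and by
-- (A) every feedback vertex set contains a copy of each x ∈ Fin n, since
-- otherwise the transversal (i, x)_i avoids it; so it has at least n elements.

open import Defs
open import Data.Nat using (ℕ; _≤_)
open import Data.Product using (_×_)

open import Data.Nat using (zero; suc; _+_; _<_; _<?_; s≤s⁻¹)
open import Data.Nat.Properties
  using (≤-refl; ≤-trans; <-trans; <⇒≤; <-irrefl; <-≤-trans; ≤-antisym;
         ≮⇒≥; n<1+n; n≤0⇒n≡0; ≤-reflexive)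
open import Data.Fin as Fin using (Fin; toℕ; fromℕ<)
import Data.Fin.Properties as Finₚ
open import Data.Product using (Σ; ∃; _,_; proj₁; proj₂)
open import Data.Sum using (_⊎_; inj₁; inj₂)
open import Data.List using (List; length; map; tabulate; lookup)
open import Data.List.Properties using (length-map; length-tabulate)
open import Data.List.Membership.Propositional using (_∈_)
open import Data.List.Membership.Propositional.Properties using (∈-map⁺; ∈-tabulate⁺)
open import Data.List.Relation.Unary.Any using (index; any?)
open import Data.List.Relation.Unary.Any.Properties using (lookup-index)
open import Data.List.Relation.Unary.Unique.Propositional using (Unique)
open import Data.List.Relation.Unary.Unique.Propositional.Properties using (tabulate⁺)
open import Data.Empty using (⊥-elim)
open import Function.Definitions using (Injective)
open import Relation.Binary.PropositionalEquality using (_≡_; refl; sym; trans; cong; subst)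
open import Relation.Nullary using (¬_; Dec; yes; no)
open import Relation.Unary using (Decidable)

-- In any digraph, a vertex set S admitting a potential h that strictly
-- increases along every arc inside S induces an acyclic subdigraph: going
-- once around a cycle h would increase and yet return to its start value.
potential⇒acyclic : (D : Digraph) (S : V D → Set) (h : V D → ℕ) →
  (∀ u v → S u → S v → Arc D u v → h u < h v) → AcyclicOn D S
potential⇒acyclic D S h increasing cycle =
  <-irrefl refl (≤-trans closing (climb len (n<1+n len)))
  where
  open DirCycleIn cycle
  step : ∀ i j → CycSucc (suc len) i j → h (vtx i) < h (vtx j)
  step i j succ = increasing _ _ (inS i) (inS j) (arcs i j succ)

  climb : ∀ t (t<l : t < suc len) → h (vtx Fin.zero) ≤ h (vtx (fromℕ< t<l))
  climb zero    _   = ≤-refl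
  climb (suc t) t<l = ≤-trans (climb t t-1<l) (<⇒≤ (step _ _ succ))
    where
    t-1<l = <-trans (n<1+n t) t<l
    toℕ-t = Finₚ.toℕ-fromℕ< t-1<l
    succ : CycSucc (suc len) (fromℕ< t-1<l) (fromℕ< t<l)
    succ = inj₁ ( subst (λ z → suc z < suc len) (sym toℕ-t) t<l
                , trans (Finₚ.toℕ-fromℕ< t<l) (cong suc (sym toℕ-t)))

  closing : h (vtx (fromℕ< (n<1+n len))) < h (vtx Fin.zero)
  closing = step _ _ (inj₂ (cong suc (Finₚ.toℕ-fromℕ< (n<1+n len)) , refl))

-- The layer index after cutting the cyclic order 0 → 1 → … → k-1 → 0 just
-- before layer c: layers below c are moved past the top, so the order becomes
-- c+1, …, k-1, k+0, …, k+(c-1).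
cutRank : (c k a : ℕ) → Dec (a < c) → ℕ
cutRank c k a (yes _) = a + k
cutRank c k a (no _)  = a

rank : (c k a : ℕ) → ℕ
rank c k a = cutRank c k a (a <? c)

rank-increasing : ∀ c k a b → ¬ a ≡ c → ¬ b ≡ c → c < k →
  ((suc a < k × b ≡ suc a) ⊎ (suc a ≡ k × b ≡ 0)) → rank c k a < rank c k b
rank-increasing c k a .(suc a) a≢c b≢c c<k (inj₁ (_ , refl))
  with a <? c | suc a <? c
... | yes _   | yes _    = ≤-refl
... | yes a<c | no a+1≮c = ⊥-elim (b≢c (≤-antisym a<c (≮⇒≥ a+1≮c)))
... | no a≮c  | yes a+1<c = ⊥-elim (a≮c (<-trans (n<1+n a) a+1<c))
... | no _    | no _     = n<1+n a
rank-increasing c .(suc a) a .0 a≢c b≢c c<k (inj₂ (refl , refl))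
  with a <? c | 0 <? c
... | yes a<c | _       = ⊥-elim (<-irrefl refl (<-≤-trans a<c (s≤s⁻¹ c<k)))
... | no _    | yes _   = ≤-refl
... | no _    | no 0≮c  = ⊥-elim (b≢c (sym (n≤0⇒n≡0 (≮⇒≥ 0≮c))))

missesLayer⇒acyclic : ∀ n k (S : V (Dnk n k) → Set) (c : Fin k) →
  (∀ x → ¬ S (c , x)) → AcyclicOn (Dnk n k) S
missesLayer⇒acyclic n k S c misses =
  potential⇒acyclic (Dnk n k) S (λ v → rank (toℕ c) k (toℕ (proj₁ v)))
    λ { (i , x) (j , y) Sv Sw arc →
        rank-increasing (toℕ c) k (toℕ i) (toℕ j)
          (λ i≡c → misses x (subst (λ l → S (l , x)) (Finₚ.toℕ-injective i≡c) Sv))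
          (λ j≡c → misses y (subst (λ l → S (l , y)) (Finₚ.toℕ-injective j≡c) Sw))
          (Finₚ.toℕ<n c) arc }

transversal-cycle : ∀ n m (S : V (Dnk n (suc m)) → Set) (f : Fin (suc m) → Fin n) →
  (∀ i → S (i , f i)) → DirCycleIn (Dnk n (suc m)) S
transversal-cycle n m S f inS = record
  { len = m ; vtx = λ i → (i , f i) ; inj = cong proj₁
  ; arcs = λ _ _ succ → succ ; inS = inS }

acyclic⇒missesLayer : ∀ n m (S : V (Dnk n (suc m)) → Set) → Decidable S →
  AcyclicOn (Dnk n (suc m)) S → ∃ λ c → ∀ x → ¬ S (c , x)
acyclic⇒missesLayer n m S S? acyclic
  with Finₚ.¬∀⟶∃¬ (suc m) (λ i → ∃ λ x → S (i , x))
         (λ i → Finₚ.any? (λ x → S? (i , x)))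
         (λ meetsAll → acyclic (transversal-cycle n m S (λ i → proj₁ (meetsAll i))
                                                       (λ i → proj₂ (meetsAll i))))
... | c , missed = c , λ x Sx → missed (x , Sx)

-- adi(D(n,k)) ≤ k: sending each colour class to a layer it misses is
-- injective, because two distinct classes missing the same layer would have
-- an acyclic union, contradicting completeness.
adi-bound : ∀ n m → AdiAtMost (Dnk n (suc m)) (suc m)
adi-bound n m r col (_ , classAcyclic , unionCyclic) = Finₚ.injective⇒≤ missed-injective
  where
  Class : Fin r → V (Dnk n (suc m)) → Set
  Class a v = col v ≡ a

  missedLayer : ∀ a → ∃ λ c → ∀ x → ¬ Class a (c , x)
  missedLayer a = acyclic⇒missesLayer n m (Class a) (λ v → col v Fin.≟ a) (classAcyclic a)

  missed-injective : Injective _≡_ _≡_ (λ a → proj₁ (missedLayer a))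
  missed-injective {a} {b} same with a Fin.≟ b
  ... | yes a≡b = a≡b
  ... | no  a≢b = ⊥-elim (missesLayer⇒acyclic n (suc m) _ (proj₁ (missedLayer a))
                            unionMisses (unionCyclic a b a≢b))
    where
    bMisses : ∀ x → ¬ Class b (proj₁ (missedLayer a) , x)
    bMisses = subst (λ c → ∀ x → ¬ Class b (c , x)) (sym same) (proj₂ (missedLayer b))
    unionMisses : ∀ x → ¬ (Class a (proj₁ (missedLayer a) , x) ⊎ Class b (proj₁ (missedLayer a) , x))
    unionMisses x (inj₁ inA) = proj₂ (missedLayer a) x inA
    unionMisses x (inj₂ inB) = bMisses x inB

layer-is-FVS : ∀ n m → Σ (List (V (Dnk n (suc m)))) λ F →
  Unique F × length F ≡ n × IsFVS (Dnk n (suc m)) F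
layer-is-FVS n m =
  layer , tabulate⁺ (cong proj₂) , length-tabulate _ ,
  missesLayer⇒acyclic n (suc m) _ Fin.zero (λ x notInLayer → notInLayer (∈-tabulate⁺ x))
  where
  layer : List (Fin (suc m) × Fin n)
  layer = tabulate (λ x → (Fin.zero , x))

-- A list containing every element of Fin n has length at least n: the
-- position of an element in the list is an injective map into its indices.
covering⇒length≥ : ∀ {n} (xs : List (Fin n)) → (∀ x → x ∈ xs) → n ≤ length xs
covering⇒length≥ xs covers = Finₚ.injective⇒≤ position-injective
  where
  position-injective : Injective _≡_ _≡_ (λ x → index (covers x))
  position-injective {x} {y} same =
    trans (lookup-index (covers x)) (trans (cong (lookup xs) same) (sym (lookup-index (covers y))))

-- By (A), a feedback vertex set contains a copy of every x ∈ Fin n: otherwise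
-- the transversal (i , x)_i avoids it.
FVS-covers-copies : ∀ n m (F : List (V (Dnk n (suc m)))) →
  IsFVS (Dnk n (suc m)) F → ∀ x → x ∈ map proj₂ F
FVS-covers-copies n m F isFVS x with any? (x Fin.≟_) (map proj₂ F)
... | yes x∈F = x∈F
... | no  x∉F = ⊥-elim (isFVS (transversal-cycle n m _ (λ _ → x)
                                 (λ i ix∈F → x∉F (∈-map⁺ proj₂ ix∈F))))

FVS-size : ∀ n m (F : List (V (Dnk n (suc m)))) → IsFVS (Dnk n (suc m)) F → n ≤ length F
FVS-size n m F isFVS =
  ≤-trans (covering⇒length≥ (map proj₂ F) (FVS-covers-copies n m F isFVS))
          (≤-reflexive (length-map proj₂ F))

proposition3p1 : (n k : ℕ) → 1 ≤ n → 3 ≤ k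
    → AdiAtMost (Dnk n k) k × TauEq (Dnk n k) n
proposition3p1 n (suc m) _ _ = adi-bound n m , layer-is-FVS n m , FVS-size n m
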